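{- Let $\mathcal D$ be a derivation in PfQPL of a formula $Q$ from a set of formulas $\mathcal H$ which is minimal. Then every axiom of $\mathcal D$ (i.e. the label of every axiom node of $\mathcal D$) is local to $\mathcal D$: it is $\top$, or it occurs in a hypothesis of $\mathcal D$ or in the conclusion of $\mathcal D$.
   Context: PfQPL is the propositional logic whose formulas are built from propositional variables and the constants $\top,\bot$ by the binary connectives $\land,\lor,\to$, given by the Hilbert-style calculus with rules (premises / conclusion): axioms $\top$ and $A\to A$ (for every formula $A$); $\land$I: $A,B\,/\,A\land B$; $\land$E: $A\land B\,/\,A$ and $A\land B\,/\,B$; $\lor$I: $A\,/\,A\lor B$ and $B\,/\,A\lor B$; $\lor$E: $A\lor A\,/\,A$; $\to$I: $B\,/\,A\to B$; $\to$E: $A,\ A\to B\,/\,B$; $\bot$E: $\bot\,/\,A$. A derivation is a finite upward-growing tree whose nodes are labeled by formulas; its leaves are axiom nodes (labeled by axioms) or hypothesis nodes; each nonleaf node with parents $a_1,\dots,a_k$ is labeled by an instance of a rule whose premises are the labels of $a_1,\dots,a_k$ and whose conclusion is the label of the node. The labels of hypothesis nodes are the hypotheses of the derivation and the root label is its conclusion; $\mathcal D$ is a derivation of $Q$ from $\mathcal H$ if its conclusion is $Q$ and all its hypotheses are in $\mathcal H$. $\mathcal D$ is minimal if there is no derivation $\mathcal D'$ with the same conclusion and fewer nodes all of whose hypotheses are hypotheses of $\mathcal D$. -}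

module Defs where

open import Data.Nat using (ℕ; suc; _+_; _<_)
open import Data.List using (List; []; _∷_; _++_; [_])
open import Data.List.Membership.Propositional using (_∈_)
open import Data.Product using (Σ; _×_)
open import Relation.Nullary using (¬_)
open import Data.Sum using (_⊎_)
open import Relation.Binary.PropositionalEquality using (_≡_)

infixr 6 _∧′_
infixr 5 _∨′_
infixr 4 _⇒_

data Formula : Set where
  var  : ℕ → Formula
  ⊤′   : Formula
  ⊥′   : Formula
  _∧′_ : Formula → Formula → Formula
  _∨′_ : Formula → Formula → Formula
  _⇒_  : Formula → Formula → Formula

-- "A occurs in B": A is a (not necessarily proper) subformula of B
data _⊑_ : Formula → Formula → Set where
  refl⊑ : ∀ {A} → A ⊑ A
  ∧ˡ : ∀ {A B C} → A ⊑ B → A ⊑ (B ∧′ C)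
  ∧ʳ : ∀ {A B C} → A ⊑ C → A ⊑ (B ∧′ C)
  ∨ˡ : ∀ {A B C} → A ⊑ B → A ⊑ (B ∨′ C)
  ∨ʳ : ∀ {A B C} → A ⊑ C → A ⊑ (B ∨′ C)
  ⇒ˡ : ∀ {A B C} → A ⊑ B → A ⊑ (B ⇒ C)
  ⇒ʳ : ∀ {A B C} → A ⊑ C → A ⊑ (B ⇒ C)

-- Derivation trees, indexed by the label of the root (the conclusion).
-- Each constructor is a node; leaves are hypothesis nodes or axiom nodes.
data Deriv : Formula → Set where
  hyp   : (A : Formula) → Deriv A
  axTop : Deriv ⊤′
  axId  : (A : Formula) → Deriv (A ⇒ A)
  ∧I    : ∀ {A B} → Deriv A → Deriv B → Deriv (A ∧′ B)
  ∧E₁   : ∀ {A} (B : Formula) → Deriv (A ∧′ B) → Deriv A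
  ∧E₂   : ∀ (A : Formula) {B} → Deriv (A ∧′ B) → Deriv B
  ∨I₁   : ∀ {A} (B : Formula) → Deriv A → Deriv (A ∨′ B)
  ∨I₂   : ∀ (A : Formula) {B} → Deriv B → Deriv (A ∨′ B)
  ∨E    : ∀ {A} → Deriv (A ∨′ A) → Deriv A
  ⇒I    : ∀ (A : Formula) {B} → Deriv B → Deriv (A ⇒ B)
  ⇒E    : ∀ (A : Formula) {B} → Deriv A → Deriv (A ⇒ B) → Deriv B
  ⊥E    : ∀ (A : Formula) → Deriv ⊥′ → Deriv A

size : ∀ {Q} → Deriv Q → ℕ
size (hyp _)    = 1
size axTop      = 1
size (axId _)   = 1
size (∧I d e)   = suc (size d + size e)
size (∧E₁ _ d)  = suc (size d)
size (∧E₂ _ d)  = suc (size d)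
size (∨I₁ _ d)  = suc (size d)
size (∨I₂ _ d)  = suc (size d)
size (∨E d)     = suc (size d)
size (⇒I _ d)   = suc (size d)
size (⇒E _ d e) = suc (size d + size e)
size (⊥E _ d)   = suc (size d)

hyps : ∀ {Q} → Deriv Q → List Formula
hyps (hyp A)    = [ A ]
hyps axTop      = []
hyps (axId _)   = []
hyps (∧I d e)   = hyps d ++ hyps e
hyps (∧E₁ _ d)  = hyps d
hyps (∧E₂ _ d)  = hyps d
hyps (∨I₁ _ d)  = hyps d
hyps (∨I₂ _ d)  = hyps d
hyps (∨E d)     = hyps d
hyps (⇒I _ d)   = hyps d
hyps (⇒E _ d e) = hyps d ++ hyps e
hyps (⊥E _ d)   = hyps d

axioms : ∀ {Q} → Deriv Q → List Formula
axioms (hyp _)    = []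
axioms axTop      = [ ⊤′ ]
axioms (axId A)   = [ A ⇒ A ]
axioms (∧I d e)   = axioms d ++ axioms e
axioms (∧E₁ _ d)  = axioms d
axioms (∧E₂ _ d)  = axioms d
axioms (∨I₁ _ d)  = axioms d
axioms (∨I₂ _ d)  = axioms d
axioms (∨E d)     = axioms d
axioms (⇒I _ d)   = axioms d
axioms (⇒E _ d e) = axioms d ++ axioms e
axioms (⊥E _ d)   = axioms d

DerivFrom : (H : Formula → Set) (Q : Formula) → Deriv Q → Set
DerivFrom H Q D = ∀ {h} → h ∈ hyps D → H h

Minimal : ∀ {Q} → Deriv Q → Set
Minimal {Q} D = ¬ (Σ (Deriv Q) λ D′ → size D′ < size D × (∀ {h} → h ∈ hyps D′ → h ∈ hyps D))

Local : ∀ {Q} → Deriv Q → Formula → Set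
Local {Q} D A = (A ≡ ⊤′) ⊎ ((Σ Formula λ h → h ∈ hyps D × A ⊑ h) ⊎ (A ⊑ Q))

-- A minimal derivation contains no detour: an elimination whose major premise
-- is an introduction of the eliminated connective, an axiom A → A, or an
-- instance of ⊥E could be cut out, leaving a derivation with fewer nodes and no
-- new hypotheses.  Hence, going up a chain of major premises, one never leaves
-- the eliminations until a hypothesis node is reached, so the major premise of
-- every elimination is a subformula of a hypothesis.  Consequently the
-- conclusion of every premise is local to the whole derivation, locality is
-- inherited down the branch from an axiom node to the root, and an axiom is
-- trivially local to the axiom node itself.
module Submission where

open import Defs
open import Data.List using (List)
open import Data.List.Membership.Propositional using (_∈_)
open import Data.List.Membership.Propositional.Properties using (∈-++⁻)
open import Data.List.Relation.Binary.Subset.Propositional using (_⊆_)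
open import Data.List.Relation.Binary.Subset.Propositional.Properties
  using (⊆-refl; ⊆-trans; ++⁺; xs⊆xs++ys; xs⊆ys++xs)
open import Data.List.Relation.Unary.Any using (here)
open import Data.Nat using (_<_; s≤s)
open import Data.Nat.Properties using (n<1+n; m≤m+n; m≤n+m; <-trans; +-monoˡ-<; +-monoʳ-<)
open import Data.Product using (Σ; _×_; _,_)
open import Data.Sum using (inj₁; inj₂)
open import Data.Empty using (⊥-elim)
open import Relation.Nullary using (¬_)
open import Relation.Binary.PropositionalEquality using (_≡_; refl)

private
  variable
    A B C Q X Y : Formula

⊑-trans : X ⊑ Y → Y ⊑ C → X ⊑ C
⊑-trans p refl⊑  = p
⊑-trans p (∧ˡ q) = ∧ˡ (⊑-trans p q)
⊑-trans p (∧ʳ q) = ∧ʳ (⊑-trans p q)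
⊑-trans p (∨ˡ q) = ∨ˡ (⊑-trans p q)
⊑-trans p (∨ʳ q) = ∨ʳ (⊑-trans p q)
⊑-trans p (⇒ˡ q) = ⇒ˡ (⊑-trans p q)
⊑-trans p (⇒ʳ q) = ⇒ʳ (⊑-trans p q)

⊑⊤⇒≡⊤ : X ⊑ ⊤′ → X ≡ ⊤′
⊑⊤⇒≡⊤ refl⊑ = refl

_OccursIn_ : Formula → List Formula → Set
X OccursIn hs = Σ Formula λ h → h ∈ hs × X ⊑ h

occursIn-⊑ : {hs : List Formula} → Y ⊑ X → X OccursIn hs → Y OccursIn hs
occursIn-⊑ Y⊑X (h , h∈hs , X⊑h) = h , h∈hs , ⊑-trans Y⊑X X⊑h

occursIn-⊆ : {hs hs′ : List Formula} → hs ⊆ hs′ → X OccursIn hs → X OccursIn hs′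
occursIn-⊆ hs⊆hs′ (h , h∈hs , X⊑h) = h , hs⊆hs′ h∈hs , X⊑h

local-⊑ : {D : Deriv Q} → Y ⊑ X → Local D X → Local D Y
local-⊑ Y⊑⊤ (inj₁ refl)              = inj₁ (⊑⊤⇒≡⊤ Y⊑⊤)
local-⊑ Y⊑X (inj₂ (inj₁ X-in-hyps)) = inj₂ (inj₁ (occursIn-⊑ Y⊑X X-in-hyps))
local-⊑ Y⊑X (inj₂ (inj₂ X⊑Q))       = inj₂ (inj₂ (⊑-trans Y⊑X X⊑Q))

record _≺_ (d : Deriv C) (D : Deriv Q) : Set where
  constructor shortcut
  field
    smaller : size d < size D
    hyps⊆   : hyps d ⊆ hyps D

open _≺_ using (smaller; hyps⊆)

≺⇒¬minimal : {d D : Deriv Q} → d ≺ D → ¬ Minimal D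
≺⇒¬minimal {d = d} (shortcut d<D d⊆D) M = M (d , d<D , d⊆D)

≺-trans : {d : Deriv C} {e : Deriv X} {D : Deriv Q} → d ≺ e → e ≺ D → d ≺ D
≺-trans (shortcut d<e d⊆e) (shortcut e<D e⊆D) = shortcut (<-trans d<e e<D) (⊆-trans d⊆e e⊆D)

data _IsMajorPremiseOf_ : Deriv C → Deriv Q → Set where
  ∧E₁ : {d : Deriv (A ∧′ B)} → d IsMajorPremiseOf ∧E₁ B d
  ∧E₂ : {d : Deriv (A ∧′ B)} → d IsMajorPremiseOf ∧E₂ A d
  ∨E  : {d : Deriv (A ∨′ A)} → d IsMajorPremiseOf ∨E d
  ⇒E  : {m : Deriv A} {d : Deriv (A ⇒ B)} → d IsMajorPremiseOf ⇒E A m d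
  ⊥E  : {d : Deriv ⊥′} → d IsMajorPremiseOf ⊥E A d

data _IsPremiseOf_ : Deriv C → Deriv Q → Set where
  major    : {d : Deriv C} {D : Deriv Q} → d IsMajorPremiseOf D → d IsPremiseOf D
  ∧I₁      : {d : Deriv A} {e : Deriv B} → d IsPremiseOf ∧I d e
  ∧I₂      : {d : Deriv A} {e : Deriv B} → e IsPremiseOf ∧I d e
  ∨I₁      : {d : Deriv A} → d IsPremiseOf ∨I₁ B d
  ∨I₂      : {d : Deriv B} → d IsPremiseOf ∨I₂ A d
  ⇒I       : {d : Deriv B} → d IsPremiseOf ⇒I A d
  ⇒E-minor : {m : Deriv A} {d : Deriv (A ⇒ B)} → m IsPremiseOf ⇒E A m d

module _ {d : Deriv C} {D : Deriv Q} where

  premise-≺ : d IsPremiseOf D → d ≺ D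
  premise-≺ (major ∧E₁)            = shortcut (n<1+n _) ⊆-refl
  premise-≺ (major ∧E₂)            = shortcut (n<1+n _) ⊆-refl
  premise-≺ (major ∨E)             = shortcut (n<1+n _) ⊆-refl
  premise-≺ (major (⇒E {m = m}))   = shortcut (s≤s (m≤n+m _ (size m))) (xs⊆ys++xs _ (hyps m))
  premise-≺ (major ⊥E)             = shortcut (n<1+n _) ⊆-refl
  premise-≺ (∧I₁ {e = e})          = shortcut (s≤s (m≤m+n _ (size e))) (xs⊆xs++ys _ (hyps e))
  premise-≺ (∧I₂ {d = d})          = shortcut (s≤s (m≤n+m _ (size d))) (xs⊆ys++xs _ (hyps d))
  premise-≺ ∨I₁                    = shortcut (n<1+n _) ⊆-refl
  premise-≺ ∨I₂                    = shortcut (n<1+n _) ⊆-refl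
  premise-≺ ⇒I                     = shortcut (n<1+n _) ⊆-refl
  premise-≺ (⇒E-minor {d = d})     = shortcut (s≤s (m≤m+n _ (size d))) (xs⊆xs++ys _ (hyps d))

  replacePremise : d IsPremiseOf D → Deriv C → Deriv Q
  replacePremise (major ∧E₁)           d′ = ∧E₁ _ d′
  replacePremise (major ∧E₂)           d′ = ∧E₂ _ d′
  replacePremise (major ∨E)            d′ = ∨E d′
  replacePremise (major (⇒E {m = m}))  d′ = ⇒E _ m d′
  replacePremise (major ⊥E)            d′ = ⊥E _ d′
  replacePremise (∧I₁ {e = e})         d′ = ∧I d′ e
  replacePremise (∧I₂ {d = d})         d′ = ∧I d d′
  replacePremise ∨I₁                   d′ = ∨I₁ _ d′
  replacePremise ∨I₂                   d′ = ∨I₂ _ d′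
  replacePremise ⇒I                    d′ = ⇒I _ d′
  replacePremise (⇒E-minor {d = d})    d′ = ⇒E _ d′ d

  replacePremise-≺ : (r : d IsPremiseOf D) {d′ : Deriv C} → d′ ≺ d → replacePremise r d′ ≺ D
  replacePremise-≺ (major ∧E₁)          (shortcut <d ⊆d) = shortcut (s≤s <d) ⊆d
  replacePremise-≺ (major ∧E₂)          (shortcut <d ⊆d) = shortcut (s≤s <d) ⊆d
  replacePremise-≺ (major ∨E)           (shortcut <d ⊆d) = shortcut (s≤s <d) ⊆d
  replacePremise-≺ (major (⇒E {m = m})) (shortcut <d ⊆d) =
    shortcut (s≤s (+-monoʳ-< (size m) <d)) (++⁺ (⊆-refl {x = hyps m}) ⊆d)
  replacePremise-≺ (major ⊥E)           (shortcut <d ⊆d) = shortcut (s≤s <d) ⊆d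
  replacePremise-≺ (∧I₁ {e = e})        (shortcut <d ⊆d) =
    shortcut (s≤s (+-monoˡ-< (size e) <d)) (++⁺ ⊆d (⊆-refl {x = hyps e}))
  replacePremise-≺ (∧I₂ {d = d})        (shortcut <d ⊆d) =
    shortcut (s≤s (+-monoʳ-< (size d) <d)) (++⁺ (⊆-refl {x = hyps d}) ⊆d)
  replacePremise-≺ ∨I₁                  (shortcut <d ⊆d) = shortcut (s≤s <d) ⊆d
  replacePremise-≺ ∨I₂                  (shortcut <d ⊆d) = shortcut (s≤s <d) ⊆d
  replacePremise-≺ ⇒I                   (shortcut <d ⊆d) = shortcut (s≤s <d) ⊆d
  replacePremise-≺ (⇒E-minor {d = d})   (shortcut <d ⊆d) =
    shortcut (s≤s (+-monoˡ-< (size d) <d)) (++⁺ ⊆d (⊆-refl {x = hyps d}))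

  premise-minimal : d IsPremiseOf D → Minimal D → Minimal d
  premise-minimal r M (d′ , d′<d , d′⊆d) = ≺⇒¬minimal (replacePremise-≺ r (shortcut d′<d d′⊆d)) M

detour⇒¬minimal : {x : Deriv Q} {e : Deriv C} {D : Deriv Q} →
  x IsPremiseOf e → e IsPremiseOf D → ¬ Minimal D
detour⇒¬minimal x◁e e◁D = ≺⇒¬minimal (≺-trans (premise-≺ x◁e) (premise-≺ e◁D))

major-premise-occursIn-hyps : {d : Deriv C} {D : Deriv Q} →
  d IsMajorPremiseOf D → Minimal D → C OccursIn hyps d
major-premise-occursIn-hyps {d = hyp A} _ _ = A , here refl , refl⊑
major-premise-occursIn-hyps {d = ∧E₁ _ d} r M =
  occursIn-⊑ (∧ˡ refl⊑) (major-premise-occursIn-hyps ∧E₁ (premise-minimal (major r) M))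
major-premise-occursIn-hyps {d = ∧E₂ _ d} r M =
  occursIn-⊑ (∧ʳ refl⊑) (major-premise-occursIn-hyps ∧E₂ (premise-minimal (major r) M))
major-premise-occursIn-hyps {d = ∨E d} r M =
  occursIn-⊑ (∨ˡ refl⊑) (major-premise-occursIn-hyps ∨E (premise-minimal (major r) M))
major-premise-occursIn-hyps {d = ⇒E _ m d} r M =
  occursIn-⊆ (xs⊆ys++xs _ (hyps m)) (occursIn-⊑ (⇒ʳ refl⊑)
    (major-premise-occursIn-hyps (⇒E {m = m}) (premise-minimal (major r) M)))
major-premise-occursIn-hyps {d = ⊥E _ d} r M = ⊥-elim (≺⇒¬minimal ⊥E-to-Q M)
  where
    -- the ⊥E node may as well conclude the conclusion of D directly
    ⊥E-to-Q : ⊥E _ d ≺ _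
    ⊥E-to-Q = shortcut (smaller (premise-≺ (major r))) (hyps⊆ (premise-≺ (major r)))
major-premise-occursIn-hyps {d = ∧I _ _} r@∧E₁ M = ⊥-elim (detour⇒¬minimal ∧I₁ (major r) M)
major-premise-occursIn-hyps {d = ∧I _ _} r@∧E₂ M = ⊥-elim (detour⇒¬minimal ∧I₂ (major r) M)
major-premise-occursIn-hyps {d = ∨I₁ _ _} r@∨E M = ⊥-elim (detour⇒¬minimal ∨I₁ (major r) M)
major-premise-occursIn-hyps {d = ∨I₂ _ _} r@∨E M = ⊥-elim (detour⇒¬minimal ∨I₂ (major r) M)
major-premise-occursIn-hyps {d = ⇒I _ _} r@⇒E M = ⊥-elim (detour⇒¬minimal ⇒I (major r) M)
major-premise-occursIn-hyps {d = axId A} ⇒E M = ⊥-elim (≺⇒¬minimal (premise-≺ (⇒E-minor {d = axId A})) M)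

premise-local : {d : Deriv C} {D : Deriv Q} → d IsPremiseOf D → Minimal D → Local D C
premise-local (major r) M =
  inj₂ (inj₁ (occursIn-⊆ (hyps⊆ (premise-≺ (major r))) (major-premise-occursIn-hyps r M)))
premise-local ∧I₁ _ = inj₂ (inj₂ (∧ˡ refl⊑))
premise-local ∧I₂ _ = inj₂ (inj₂ (∧ʳ refl⊑))
premise-local ∨I₁ _ = inj₂ (inj₂ (∨ˡ refl⊑))
premise-local ∨I₂ _ = inj₂ (inj₂ (∨ʳ refl⊑))
premise-local ⇒I  _ = inj₂ (inj₂ (⇒ʳ refl⊑))
premise-local {D = D} ⇒E-minor M = local-⊑ {D = D} (⇒ˡ refl⊑) (premise-local {D = D} (major ⇒E) M)

local-from-premise : {d : Deriv C} {D : Deriv Q} → d IsPremiseOf D → Minimal D →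
  (Minimal d → Local d A) → Local D A
local-from-premise {D = D} r M local-d with local-d (premise-minimal r M)
... | inj₁ A≡⊤           = inj₁ A≡⊤
... | inj₂ (inj₁ A-in-d) = inj₂ (inj₁ (occursIn-⊆ (hyps⊆ (premise-≺ r)) A-in-d))
... | inj₂ (inj₂ A⊑C)    = local-⊑ {D = D} A⊑C (premise-local r M)

axioms-local : (D : Deriv Q) → A ∈ axioms D → Minimal D → Local D A
axioms-local axTop    (here refl) _ = inj₁ refl
axioms-local (axId _) (here refl) _ = inj₂ (inj₂ refl⊑)
axioms-local (∧I d e) A∈ M with ∈-++⁻ (axioms d) A∈
... | inj₁ A∈d = local-from-premise ∧I₁ M (axioms-local d A∈d)
... | inj₂ A∈e = local-from-premise ∧I₂ M (axioms-local e A∈e)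
axioms-local (∧E₁ _ d) A∈ M = local-from-premise (major ∧E₁) M (axioms-local d A∈)
axioms-local (∧E₂ _ d) A∈ M = local-from-premise (major ∧E₂) M (axioms-local d A∈)
axioms-local (∨I₁ _ d) A∈ M = local-from-premise ∨I₁ M (axioms-local d A∈)
axioms-local (∨I₂ _ d) A∈ M = local-from-premise ∨I₂ M (axioms-local d A∈)
axioms-local (∨E d)    A∈ M = local-from-premise (major ∨E) M (axioms-local d A∈)
axioms-local (⇒I _ d)  A∈ M = local-from-premise ⇒I M (axioms-local d A∈)
axioms-local (⇒E _ m d) A∈ M with ∈-++⁻ (axioms m) A∈
... | inj₁ A∈m = local-from-premise ⇒E-minor M (axioms-local m A∈m)
... | inj₂ A∈d = local-from-premise (major ⇒E) M (axioms-local d A∈d)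
axioms-local (⊥E _ d)  A∈ M = local-from-premise (major ⊥E) M (axioms-local d A∈)

-- Minimality only refers to the hypotheses of D itself.
lemma5p5 : (H : Formula → Set) (Q : Formula) (D : Deriv Q) →
    DerivFrom H Q D → Minimal D →
    ∀ {A} → A ∈ axioms D → Local D A
lemma5p5 _ _ D _ M A∈ = axioms-local D A∈ M
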